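{- Let $R_1,\dots,R_n:\{0,1,2\}\to\mathbb{R}$ with $R_j(0)=0$, put $a_j=R_j(1)$, $b_j=R_j(2)-R_j(1)$, $A=\{j: a_j>b_j\}$, $B=\{j:a_j\le b_j\}$. For $0\le k\le 2|A|$ let $f(k)$ be the maximum of $\sum_{j\in A}R_j(x_j)$ over $x_j\in\{0,1,2\}$ with $\sum_{j\in A}x_j=k$, and for $0\le k\le 2|B|$ let $g(k)$ be the analogous maximum over the projects in $B$. Then (1) $f$ is concave, and (2) $g$ is oscillating concave.
   Context: $f$ concave means $f(i+1)-f(i)$ is nonincreasing in $i$. A function $g$ is oscillating concave if, for all $k$ for which the terms are defined: (1) $g(2k)-g(2k-2)\ge g(2k+2)-g(2k)$; (2) $g(2k+2)-g(2k+1)\ge g(2k+1)-g(2k)$; (3) $g(2k+1)-g(2k)\le g(2k)-g(2k-1)$; (4) $g(2k+1)-g(2k)$ is (weakly) decreasing in $k$; (5) $g(2k)-g(2k-1)$ is (weakly) decreasing in $k$.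
   Formalization: The reward functions $R_j$ take values in ℚ instead of ℝ, so the maxima f and g are rational as well. -}

module Defs where

open import Data.Nat as ℕ using (ℕ; zero; suc)
open import Data.Fin using (Fin; zero; suc; toℕ)
open import Data.List using (List; filter; map; length; foldr)
open import Data.List.Base using (allFin)
open import Data.Product using (Σ; _×_)
open import Data.Rational using (ℚ; 0ℚ; _+_; _-_; _≤_; _<?_; _≤?_)
open import Relation.Binary.PropositionalEquality using (_≡_)

Rewards : ℕ → Set
Rewards n = Fin n → Fin 3 → ℚ

one two : Fin 3
one = suc zero
two = suc (suc zero)

aOf bOf : ∀ {n} → Rewards n → Fin n → ℚ
aOf R j = R j one
bOf R j = R j two - R j one

Aset Bset : ∀ {n} → Rewards n → List (Fin n)
Aset {n} R = filter (λ j → bOf R j <? aOf R j) (allFin n)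
Bset {n} R = filter (λ j → aOf R j ≤? bOf R j) (allFin n)

sumℚ : List ℚ → ℚ
sumℚ = foldr _+_ 0ℚ

sumℕ : List ℕ → ℕ
sumℕ = foldr ℕ._+_ 0

-- an allocation x_j ∈ {0,1,2} (only its values on the index set S matter)
Alloc : ℕ → Set
Alloc n = Fin n → Fin 3

load : ∀ {n} → List (Fin n) → Alloc n → ℕ
load S x = sumℕ (map (λ j → toℕ (x j)) S)

value : ∀ {n} → Rewards n → List (Fin n) → Alloc n → ℚ
value R S x = sumℚ (map (λ j → R j (x j)) S)

IsMaxValue : ∀ {n} → Rewards n → List (Fin n) → ℕ → ℚ → Set
IsMaxValue R S k v =
  Σ (Alloc _) (λ x → (load S x ≡ k) × (value R S x ≡ v))
  × (∀ (x : Alloc _) → load S x ≡ k → value R S x ≤ v)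

Concave : ℕ → (ℕ → ℚ) → Set
Concave N f = ∀ i → 2 ℕ.+ i ℕ.≤ N → f (2 ℕ.+ i) - f (1 ℕ.+ i) ≤ f (1 ℕ.+ i) - f i

-- g oscillating concave on {0,…,M}; each condition for all k with all terms defined.
-- Where the condition involves 2k-1 or 2k-2 we write k = m+1.
OscConcave : ℕ → (ℕ → ℚ) → Set
OscConcave M g =
  -- (1) g(2k)-g(2k-2) ≥ g(2k+2)-g(2k),  k = m+1
  (∀ m → 2 ℕ.* m ℕ.+ 4 ℕ.≤ M →
     g (2 ℕ.* m ℕ.+ 4) - g (2 ℕ.* m ℕ.+ 2) ≤ g (2 ℕ.* m ℕ.+ 2) - g (2 ℕ.* m))
  -- (2) g(2k+2)-g(2k+1) ≥ g(2k+1)-g(2k)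
  × (∀ k → 2 ℕ.* k ℕ.+ 2 ℕ.≤ M →
     g (2 ℕ.* k ℕ.+ 1) - g (2 ℕ.* k) ≤ g (2 ℕ.* k ℕ.+ 2) - g (2 ℕ.* k ℕ.+ 1))
  -- (3) g(2k+1)-g(2k) ≤ g(2k)-g(2k-1),  k = m+1
  × (∀ m → 2 ℕ.* m ℕ.+ 3 ℕ.≤ M →
     g (2 ℕ.* m ℕ.+ 3) - g (2 ℕ.* m ℕ.+ 2) ≤ g (2 ℕ.* m ℕ.+ 2) - g (2 ℕ.* m ℕ.+ 1))
  -- (4) g(2k+1)-g(2k) weakly decreasing in k
  × (∀ k → 2 ℕ.* k ℕ.+ 3 ℕ.≤ M →
     g (2 ℕ.* k ℕ.+ 3) - g (2 ℕ.* k ℕ.+ 2) ≤ g (2 ℕ.* k ℕ.+ 1) - g (2 ℕ.* k))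
  -- (5) g(2k)-g(2k-1) weakly decreasing in k (k ≥ 1), k = m+1
  × (∀ m → 2 ℕ.* m ℕ.+ 4 ℕ.≤ M →
     g (2 ℕ.* m ℕ.+ 4) - g (2 ℕ.* m ℕ.+ 3) ≤ g (2 ℕ.* m ℕ.+ 2) - g (2 ℕ.* m ℕ.+ 1))

{-# OPTIONS --safe #-}
module Submission where

open import Defs
open import Data.Nat using (ℕ; _*_; _≤_)
open import Data.Fin using (Fin; zero)
open import Data.List using (length)
open import Data.Product using (_×_)
open import Data.Rational using (ℚ; 0ℚ)
open import Relation.Binary.PropositionalEquality using (_≡_)

open import Algebra.Bundles using (CommutativeMonoid)
import Algebra.Properties.CommutativeSemigroup as CommSemigroupProperties
open import Data.Fin using (suc; toℕ)
open import Data.List using (List; []; _∷_; allFin)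
open import Data.List.Relation.Unary.All as ListAll using ([]; _∷_)
open import Data.List.Relation.Unary.All.Properties using (all-filter)
open import Data.List.Relation.Unary.AllPairs using (_∷_)
open import Data.List.Relation.Unary.Unique.Propositional using (Unique)
open import Data.List.Relation.Unary.Unique.Propositional.Properties using (filter⁺; allFin⁺)
open import Data.Nat as ℕ using (suc; z≤n; s≤s)
import Data.Nat.Properties as ℕ
open import Data.Nat.Tactic.RingSolver using (solve-∀)
open import Data.Product using (Σ; _,_)
open import Data.Rational as ℚ using (_+_; _-_; -_; _<?_; _≤?_)
import Data.Rational.Properties as ℚ
open import Data.Rational.Solver using (module +-*-Solver)
open import Data.Sum using (_⊎_; inj₁; inj₂; [_,_]′) renaming (map to map⊎)
open import Data.Vec as Vec using (Vec; []; _∷_)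
open import Data.Vec.Functional using (updateAt)
open import Data.Vec.Functional.Properties using (updateAt-updates; updateAt-minimal)
open import Data.Vec.Relation.Unary.All as VecAll using ([]; _∷_)
open import Data.Vec.Relation.Unary.All.Properties using (map⁺; fromList⁺)
open import Data.Vec.Relation.Unary.Any using (Any; here; there)
open import Function using (const; _$_)
open import Relation.Binary.PropositionalEquality using (refl; sym; trans; cong; cong₂; subst; ≢-sym)
open import Relation.Nullary using (contradiction)

-- Both parts are exchange arguments between two optimal allocations x and y, written as vectors
-- over {0,1,2}, with size x ≥ size y + d. Walking through the projects, where x_j > y_j one may
-- swap x_j and y_j, which moves x_j - y_j units from x to y at no cost, and one may replace
-- (x_j, y_j) = (2, 0) by (1, 1) at no loss when R_j(2) + R_j(0) ≤ 2 R_j(1), which for R_j(0) = 0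
-- holds as soon as a_j > b_j. So for the projects in A one unit can always be moved, which gives
-- f(k+2) + f(k) ≤ 2 f(k+1), while for arbitrary rewards exactly two units can be moved, which
-- gives the inequalities (1), (4), (5) between values of g two apart. On B every R_j is convex
-- instead; an optimal allocation of odd size 2k+1 has some x_j = 1, and splitting (1, 1) into
-- (0, 2) at j in two copies of it gives 2 g(2k+1) ≤ g(2k) + g(2k+2), which is (2). Finally (3)
-- follows from (1) at m and (2) at m and m+1 by comparing increments.

private
  variable
    m n : ℕ
    rs : Vec (Fin 3 → ℚ) m

open CommSemigroupProperties ℕ.+-commutativeSemigroup
  using () renaming (interchange to ℕ-interchange)
open CommSemigroupProperties (CommutativeMonoid.commutativeSemigroup ℚ.+-0-commutativeMonoid)
  using () renaming (interchange to ℚ-interchange)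

p+q≤r+s⇒p-s≤r-q : ∀ p q r s → p + q ℚ.≤ r + s → p - s ℚ.≤ r - q
p+q≤r+s⇒p-s≤r-q p q r s p+q≤r+s = begin
  p - s              ≡⟨ solve 3 (λ p q s → p :- s := (p :+ q) :- (q :+ s)) refl p q s ⟩
  p + q - (q + s)    ≤⟨ ℚ.+-monoˡ-≤ (- (q + s)) p+q≤r+s ⟩
  r + s - (q + s)    ≡⟨ solve 3 (λ q r s → (r :+ s) :- (q :+ s) := r :- q) refl q r s ⟩
  r - q              ∎
  where open ℚ.≤-Reasoning; open +-*-Solver

p+p≤q+q⇒p≤q : ∀ {p q} → p + p ℚ.≤ q + q → p ℚ.≤ q
p+p≤q+q⇒p≤q p+p≤q+q =
  ℚ.≮⇒≥ (λ q<p → ℚ.<-irrefl refl (ℚ.<-≤-trans (ℚ.+-mono-< q<p q<p) p+p≤q+q))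

increment-squeeze : ∀ a b c d e →
                    d - c ℚ.≤ e - d → b - a ℚ.≤ c - b → e - c ℚ.≤ c - a → d - c ℚ.≤ c - b
increment-squeeze a b c d e d-c≤e-d b-a≤c-b e-c≤c-a = p+p≤q+q⇒p≤q (begin
  (d - c) + (d - c)  ≤⟨ ℚ.+-monoʳ-≤ (d - c) d-c≤e-d ⟩
  (d - c) + (e - d)  ≡⟨ solve 3 (λ c d e → (d :- c) :+ (e :- d) := e :- c) refl c d e ⟩
  e - c              ≤⟨ e-c≤c-a ⟩
  c - a              ≡⟨ solve 3 (λ a b c → c :- a := (b :- a) :+ (c :- b)) refl a b c ⟩
  (b - a) + (c - b)  ≤⟨ ℚ.+-monoˡ-≤ (c - b) b-a≤c-b ⟩
  (c - b) + (c - b)  ∎)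
  where open ℚ.≤-Reasoning; open +-*-Solver

2m+3≡1+2[1+m] : ∀ m → 2 * m ℕ.+ 3 ≡ suc (2 * suc m)
2m+3≡1+2[1+m] = solve-∀

2m+3≤2l⇒2m+4≤2l : ∀ m l → 2 * m ℕ.+ 3 ≤ 2 * l → 2 * m ℕ.+ 4 ≤ 2 * l
2m+3≤2l⇒2m+4≤2l m l 2m+3≤2l with ℕ.m≤n⇒m<n∨m≡n 2m+3≤2l
... | inj₁ 2m+3<2l = subst (_≤ 2 * l) (sym (ℕ.+-suc (2 * m) 3)) 2m+3<2l
... | inj₂ 2m+3≡2l = contradiction (trans (sym 2m+3≡2l) (2m+3≡1+2[1+m] m)) (ℕ.even≢odd l (suc m))

Concave₃ Convex₃ : (Fin 3 → ℚ) → Set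
Concave₃ r = r two + r zero ℚ.≤ r one + r one
Convex₃ r = r one + r one ℚ.≤ r zero + r two

size : Vec (Fin 3) m → ℕ
size [] = 0
size (a ∷ x) = toℕ a ℕ.+ size x

reward : Vec (Fin 3 → ℚ) m → Vec (Fin 3) m → ℚ
reward [] [] = 0ℚ
reward (r ∷ rs) (a ∷ x) = r a + reward rs x

record Transfer (rs : Vec (Fin 3 → ℚ) m) (d : ℕ) (x y : Vec (Fin 3) m) : Set where
  constructor transfer
  field
    x′ y′ : Vec (Fin 3) m
    size-x′ : size x′ ℕ.+ d ≡ size x
    size-y′ : size y′ ≡ size y ℕ.+ d
    gain : reward rs x + reward rs y ℚ.≤ reward rs x′ + reward rs y′

transfer-zero : ∀ {x y} → Transfer rs 0 x y
transfer-zero {x = x} {y} =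
  transfer x y (ℕ.+-identityʳ (size x)) (sym (ℕ.+-identityʳ (size y))) ℚ.≤-refl

transfer-∷ : ∀ {e a b x y} r a′ b′ c → toℕ a′ ℕ.+ c ≡ toℕ a → toℕ b′ ≡ toℕ b ℕ.+ c →
             r a + r b ℚ.≤ r a′ + r b′ →
             Transfer rs e x y → Transfer (r ∷ rs) (c ℕ.+ e) (a ∷ x) (b ∷ y)
transfer-∷ {rs = rs} {e} {a} {b} {x} {y} r a′ b′ c size-a′ size-b′ gain-r
           (transfer x′ y′ size-x′ size-y′ gain) =
  transfer (a′ ∷ x′) (b′ ∷ y′)
    (trans (ℕ-interchange (toℕ a′) (size x′) c e) (cong₂ ℕ._+_ size-a′ size-x′))
    (trans (cong₂ ℕ._+_ size-b′ size-y′) (ℕ-interchange (toℕ b) c (size y) e))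
    (begin
      (r a + reward rs x) + (r b + reward rs y)      ≡⟨ ℚ-interchange (r a) _ (r b) _ ⟩
      (r a + r b) + (reward rs x + reward rs y)      ≤⟨ ℚ.+-mono-≤ gain-r gain ⟩
      (r a′ + r b′) + (reward rs x′ + reward rs y′)  ≡⟨ ℚ-interchange (r a′) (r b′) _ _ ⟩
      (r a′ + reward rs x′) + (r b′ + reward rs y′)  ∎)
  where open ℚ.≤-Reasoning

transfer-keep : ∀ {e a b x y} r → Transfer rs e x y → Transfer (r ∷ rs) e (a ∷ x) (b ∷ y)
transfer-keep {a = a} {b} r =
  transfer-∷ r a b 0 (ℕ.+-identityʳ (toℕ a)) (sym (ℕ.+-identityʳ (toℕ b))) ℚ.≤-refl

transfer-swap : ∀ {e a b x y} r c → toℕ b ℕ.+ c ≡ toℕ a →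
                Transfer rs e x y → Transfer (r ∷ rs) (c ℕ.+ e) (a ∷ x) (b ∷ y)
transfer-swap {a = a} {b} r c b+c≡a =
  transfer-∷ r b a c b+c≡a (sym b+c≡a) (ℚ.≤-reflexive (ℚ.+-comm (r a) (r b)))

gap-tail : ∀ (a b : Fin 3) (x y : Vec (Fin 3) m) {c d} → toℕ a ≤ toℕ b ℕ.+ c →
           size (b ∷ y) ℕ.+ (c ℕ.+ d) ≤ size (a ∷ x) → size y ℕ.+ d ≤ size x
gap-tail a b x y {c} {d} a≤b+c gap = ℕ.+-cancelˡ-≤ (toℕ a) _ _ (begin
  toℕ a ℕ.+ (size y ℕ.+ d)           ≤⟨ ℕ.+-monoˡ-≤ (size y ℕ.+ d) a≤b+c ⟩
  (toℕ b ℕ.+ c) ℕ.+ (size y ℕ.+ d)   ≡⟨ ℕ-interchange (toℕ b) c (size y) d ⟩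
  (toℕ b ℕ.+ size y) ℕ.+ (c ℕ.+ d)   ≤⟨ gap ⟩
  toℕ a ℕ.+ size x                   ∎)
  where open ℕ.≤-Reasoning

data Comparison₃ : Fin 3 → Fin 3 → Set where
  leq : ∀ {a b} → toℕ a ≤ toℕ b → Comparison₃ a b
  1>0 : Comparison₃ one zero
  2>0 : Comparison₃ two zero
  2>1 : Comparison₃ two one

compare₃ : ∀ a b → Comparison₃ a b
compare₃ zero b = leq z≤n
compare₃ (suc zero) zero = 1>0
compare₃ (suc zero) (suc b) = leq (s≤s z≤n)
compare₃ (suc (suc zero)) zero = 2>0
compare₃ (suc (suc zero)) (suc zero) = 2>1
compare₃ (suc (suc zero)) (suc (suc zero)) = leq ℕ.≤-refl

transfer-one-or-two : ∀ (rs : Vec (Fin 3 → ℚ) m) {x y} →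
                      size y ℕ.+ 1 ≤ size x → Transfer rs 1 x y ⊎ Transfer rs 2 x y
transfer-one-or-two [] {[]} {[]} ()
transfer-one-or-two (r ∷ rs) {a ∷ x} {b ∷ y} gap with compare₃ a b
... | leq a≤b = map⊎ (transfer-keep r) (transfer-keep r)
                     (transfer-one-or-two rs (gap-tail a b x y (ℕ.m≤n⇒m≤n+o 0 a≤b) gap))
... | 1>0 = inj₁ (transfer-swap r 1 refl transfer-zero)
... | 2>0 = inj₂ (transfer-swap r 2 refl transfer-zero)
... | 2>1 = inj₁ (transfer-swap r 1 refl transfer-zero)

transfer-two : ∀ (rs : Vec (Fin 3 → ℚ) m) {x y} → size y ℕ.+ 2 ≤ size x → Transfer rs 2 x y
transfer-two [] {[]} {[]} ()
transfer-two (r ∷ rs) {a ∷ x} {b ∷ y} gap with compare₃ a b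
... | leq a≤b = transfer-keep r (transfer-two rs (gap-tail a b x y (ℕ.m≤n⇒m≤n+o 0 a≤b) gap))
... | 1>0 = [ transfer-swap r 1 refl , transfer-keep r ]′
             (transfer-one-or-two rs (gap-tail one zero x y ℕ.≤-refl gap))
... | 2>0 = transfer-swap r 2 refl transfer-zero
... | 2>1 = [ transfer-swap r 1 refl , transfer-keep r ]′
             (transfer-one-or-two rs (gap-tail two one x y ℕ.≤-refl gap))

transfer-one : VecAll.All Concave₃ rs → ∀ {x y} → size y ℕ.+ 1 ≤ size x → Transfer rs 1 x y
transfer-one {rs = []} [] {[]} {[]} ()
transfer-one {rs = r ∷ rs} (concave ∷ concaves) {a ∷ x} {b ∷ y} gap with compare₃ a b
... | leq a≤b = transfer-keep r (transfer-one concaves (gap-tail a b x y (ℕ.m≤n⇒m≤n+o 0 a≤b) gap))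
... | 1>0 = transfer-swap r 1 refl transfer-zero
... | 2>0 = transfer-∷ r one one 1 refl refl concave transfer-zero
... | 2>1 = transfer-swap r 1 refl transfer-zero

transfer-split : VecAll.All Convex₃ rs → ∀ {x} → Any (_≡ one) x → Transfer rs 1 x x
transfer-split {rs = r ∷ rs} (convex ∷ _) (here refl) =
  transfer-∷ r zero two 1 refl refl convex transfer-zero
transfer-split {rs = r ∷ rs} (_ ∷ convexes) (there has-one) =
  transfer-keep r (transfer-split convexes has-one)

odd-size⇒has-one : ∀ k (x : Vec (Fin 3) m) → size x ≡ suc (2 * k) → Any (_≡ one) x
odd-size⇒has-one k [] ()
odd-size⇒has-one k (zero ∷ x) odd = there (odd-size⇒has-one k x odd)
odd-size⇒has-one k (suc zero ∷ x) _ = here refl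
odd-size⇒has-one ℕ.zero (suc (suc zero) ∷ x) ()
odd-size⇒has-one (suc k) (suc (suc zero) ∷ x) odd =
  there (odd-size⇒has-one k x (trans (ℕ.suc-injective (ℕ.suc-injective odd)) (ℕ.+-suc k (k ℕ.+ 0))))

record IsMaxReward (rs : Vec (Fin 3 → ℚ) m) (k : ℕ) (v : ℚ) : Set where
  field
    argmax : Vec (Fin 3) m
    size-argmax : size argmax ≡ k
    reward-argmax : reward rs argmax ≡ v
    maximal : ∀ x → size x ≡ k → reward rs x ℚ.≤ v

open IsMaxReward

transfer-≤ : ∀ {p q d a b a′ b′} (X : IsMaxReward rs (p ℕ.+ d) a) (Y : IsMaxReward rs q b) →
             IsMaxReward rs p a′ → IsMaxReward rs (q ℕ.+ d) b′ →
             Transfer rs d (argmax X) (argmax Y) → a + b ℚ.≤ a′ + b′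
transfer-≤ {rs = rs} {p} {q} {d} {a} {b} {a′} {b′} X Y X′ Y′
           (transfer x′ y′ size-x′ size-y′ gain) = begin
  a + b                                        ≡⟨ sym (cong₂ _+_ (reward-argmax X) (reward-argmax Y)) ⟩
  reward rs (argmax X) + reward rs (argmax Y)  ≤⟨ gain ⟩
  reward rs x′ + reward rs y′                  ≤⟨ ℚ.+-mono-≤ (maximal X′ x′ size≡p) (maximal Y′ y′ size≡q+d) ⟩
  a′ + b′                                      ∎
  where
  open ℚ.≤-Reasoning
  size≡p : size x′ ≡ p
  size≡p = ℕ.+-cancelʳ-≡ d (size x′) p (trans size-x′ (size-argmax X))
  size≡q+d : size y′ ≡ q ℕ.+ d
  size≡q+d = trans size-y′ (cong (ℕ._+ d) (size-argmax Y))

max-shift : ∀ {N d p q p′ q′} (F : ℕ → ℚ) → (∀ k → k ≤ N → IsMaxReward rs k (F k)) →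
            (∀ {x y} → size y ℕ.+ d ≤ size x → Transfer rs d x y) →
            q ≤ p → p′ ≡ p ℕ.+ d → q′ ≡ q ℕ.+ d → p′ ≤ N → F p′ - F q′ ℚ.≤ F p - F q
max-shift {rs = rs} {N} {d} {p} {q} F isMax move q≤p refl refl p+d≤N =
  p+q≤r+s⇒p-s≤r-q (F (p ℕ.+ d)) (F q) (F p) (F (q ℕ.+ d)) $
  transfer-≤ X Y (isMax p p≤N) (isMax (q ℕ.+ d) (ℕ.≤-trans q+d≤p+d p+d≤N)) (move gap)
  where
  q+d≤p+d : q ℕ.+ d ≤ p ℕ.+ d
  q+d≤p+d = ℕ.+-monoˡ-≤ d q≤p
  p≤N : p ≤ N
  p≤N = ℕ.≤-trans (ℕ.m≤m+n p d) p+d≤N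
  X : IsMaxReward rs (p ℕ.+ d) (F (p ℕ.+ d))
  X = isMax (p ℕ.+ d) p+d≤N
  Y : IsMaxReward rs q (F q)
  Y = isMax q (ℕ.≤-trans q≤p p≤N)
  gap : size (argmax Y) ℕ.+ d ≤ size (argmax X)
  gap rewrite size-argmax X | size-argmax Y = q+d≤p+d

max-spread : ∀ {N d p o t} (F : ℕ → ℚ) → (∀ k → k ≤ N → IsMaxReward rs k (F k)) →
             (∀ {x} → size x ≡ o → Transfer rs d x x) →
             p ℕ.+ d ≡ o → o ℕ.+ d ≡ t → t ≤ N → F o - F p ℚ.≤ F t - F o
max-spread {rs = rs} {N} {d} {p} F isMax move refl refl t≤N =
  p+q≤r+s⇒p-s≤r-q (F o) (F o) (F t) (F p) $ begin
    F o + F o  ≤⟨ transfer-≤ O O (isMax p p≤N) (isMax t t≤N) (move (size-argmax O)) ⟩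
    F p + F t  ≡⟨ ℚ.+-comm (F p) (F t) ⟩
    F t + F p  ∎
  where
  open ℚ.≤-Reasoning
  o t : ℕ
  o = p ℕ.+ d
  t = o ℕ.+ d
  o≤N : o ≤ N
  o≤N = ℕ.≤-trans (ℕ.m≤m+n o d) t≤N
  p≤N : p ≤ N
  p≤N = ℕ.≤-trans (ℕ.m≤m+n p d) o≤N
  O : IsMaxReward rs o (F o)
  O = isMax o o≤N

maxReward-concave : ∀ {N} (F : ℕ → ℚ) → VecAll.All Concave₃ rs →
                    (∀ k → k ≤ N → IsMaxReward rs k (F k)) → Concave N F
maxReward-concave F concave isMax i =
  max-shift F isMax (transfer-one concave) (ℕ.n≤1+n i) (cong suc (ℕ.+-comm 1 i)) (ℕ.+-comm 1 i)

maxReward-oscConcave : ∀ l (F : ℕ → ℚ) → VecAll.All Convex₃ rs →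
                       (∀ k → k ≤ 2 * l → IsMaxReward rs k (F k)) → OscConcave (2 * l) F
maxReward-oscConcave {rs = rs} l F convex isMax =
    even-shift
  , odd-spread
  , odd-squeeze
  , (λ k → shift₂ (ℕ.m≤m+n (2 * k) 1) (sym (ℕ.+-assoc (2 * k) 1 2)) refl)
  , (λ m → shift₂ (ℕ.+-monoʳ-≤ (2 * m) (s≤s z≤n))
                  (sym (ℕ.+-assoc (2 * m) 2 2)) (sym (ℕ.+-assoc (2 * m) 1 2)))
  where
  shift₂ : ∀ {p q p′ q′} → q ≤ p → p′ ≡ p ℕ.+ 2 → q′ ≡ q ℕ.+ 2 → p′ ≤ 2 * l →
           F p′ - F q′ ℚ.≤ F p - F q
  shift₂ = max-shift F isMax (transfer-two rs)

  spread₁ : ∀ k {p o t} → p ℕ.+ 1 ≡ o → o ℕ.+ 1 ≡ t → o ≡ suc (2 * k) → t ≤ 2 * l →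
            F o - F p ℚ.≤ F t - F o
  spread₁ k p+1≡o o+1≡t o-odd = max-spread F isMax
    (λ {x} size≡o → transfer-split convex (odd-size⇒has-one k x (trans size≡o o-odd))) p+1≡o o+1≡t

  even-shift : ∀ m → 2 * m ℕ.+ 4 ≤ 2 * l →
               F (2 * m ℕ.+ 4) - F (2 * m ℕ.+ 2) ℚ.≤ F (2 * m ℕ.+ 2) - F (2 * m)
  even-shift m = shift₂ (ℕ.m≤m+n (2 * m) 2) (sym (ℕ.+-assoc (2 * m) 2 2)) refl

  odd-spread : ∀ k → 2 * k ℕ.+ 2 ≤ 2 * l →
               F (2 * k ℕ.+ 1) - F (2 * k) ℚ.≤ F (2 * k ℕ.+ 2) - F (2 * k ℕ.+ 1)
  odd-spread k = spread₁ k refl (ℕ.+-assoc (2 * k) 1 1) (ℕ.+-comm (2 * k) 1)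

  odd-squeeze : ∀ m → 2 * m ℕ.+ 3 ≤ 2 * l →
                F (2 * m ℕ.+ 3) - F (2 * m ℕ.+ 2) ℚ.≤ F (2 * m ℕ.+ 2) - F (2 * m ℕ.+ 1)
  odd-squeeze m 2m+3≤2l =
    increment-squeeze (F (2 * m)) (F (2 * m ℕ.+ 1)) (F (2 * m ℕ.+ 2)) (F (2 * m ℕ.+ 3)) (F (2 * m ℕ.+ 4))
      (spread₁ (suc m) (ℕ.+-assoc (2 * m) 2 1) (ℕ.+-assoc (2 * m) 3 1) (2m+3≡1+2[1+m] m) 2m+4≤2l)
      (odd-spread m (ℕ.≤-trans (ℕ.+-monoʳ-≤ (2 * m) (ℕ.m≤m+n 2 2)) 2m+4≤2l))
      (even-shift m 2m+4≤2l)
    where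
    2m+4≤2l : 2 * m ℕ.+ 4 ≤ 2 * l
    2m+4≤2l = 2m+3≤2l⇒2m+4≤2l m l 2m+3≤2l

restrict : {A : Set} → (Fin n → A) → (S : List (Fin n)) → Vec A (length S)
restrict x S = Vec.map x (Vec.fromList S)

size-restrict : ∀ (S : List (Fin n)) x → size (restrict x S) ≡ load S x
size-restrict [] x = refl
size-restrict (j ∷ S) x = cong (toℕ (x j) ℕ.+_) (size-restrict S x)

reward-restrict : ∀ (R : Rewards n) S x → reward (restrict R S) (restrict x S) ≡ value R S x
reward-restrict R [] x = refl
reward-restrict R (j ∷ S) x = cong (R j (x j) +_) (reward-restrict R S x)

restrict-cong : {A : Set} {x y : Fin n → A} {S : List (Fin n)} →
                ListAll.All (λ i → x i ≡ y i) S → restrict x S ≡ restrict y S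
restrict-cong [] = refl
restrict-cong (x≡y ∷ x≡ys) = cong₂ _∷_ x≡y (restrict-cong x≡ys)

restrict-surjective : {S : List (Fin n)} → Unique S →
                      (u : Vec (Fin 3) (length S)) → Σ (Alloc n) (λ x → restrict x S ≡ u)
restrict-surjective {S = []} _ [] = const zero , refl
restrict-surjective {S = j ∷ S} (j∉S ∷ unique) (c ∷ u) with restrict-surjective unique u
... | x , refl =
  updateAt x j (const c) ,
  cong₂ _∷_ (updateAt-updates j x)
            (restrict-cong (ListAll.map (λ j≢i → updateAt-minimal _ j x (≢-sym j≢i)) j∉S))

max-restrict : ∀ {R : Rewards n} {S k v} → Unique S → IsMaxValue R S k v →
               IsMaxReward (restrict R S) k v
max-restrict {R = R} {S} {k} {v} unique ((x , load≡k , value≡v) , maximal-value) = record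
  { argmax = restrict x S
  ; size-argmax = trans (size-restrict S x) load≡k
  ; reward-argmax = trans (reward-restrict R S x) value≡v
  ; maximal = maximal-restrict
  }
  where
  maximal-restrict : ∀ u → size u ≡ k → reward (restrict R S) u ℚ.≤ v
  maximal-restrict u size≡k with restrict-surjective unique u
  ... | y , refl = ℚ.≤-trans (ℚ.≤-reflexive (reward-restrict R S y))
                             (maximal-value y (trans (sym (size-restrict S y)) size≡k))

b<a⇒concave₃ : ∀ (R : Rewards n) j → R j zero ≡ 0ℚ → bOf R j ℚ.< aOf R j → Concave₃ (R j)
b<a⇒concave₃ R j R0≡0 b<a = begin
  R j two + R j zero             ≡⟨ cong (R j two +_) R0≡0 ⟩
  R j two + 0ℚ                   ≡⟨ solve 2 (λ a c → c :+ con 0ℚ := (c :- a) :+ a) refl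
                                           (R j one) (R j two) ⟩
  (R j two - R j one) + R j one  ≤⟨ ℚ.+-monoˡ-≤ (R j one) (ℚ.<⇒≤ b<a) ⟩
  R j one + R j one              ∎
  where open ℚ.≤-Reasoning; open +-*-Solver

a≤b⇒convex₃ : ∀ (R : Rewards n) j → R j zero ≡ 0ℚ → aOf R j ℚ.≤ bOf R j → Convex₃ (R j)
a≤b⇒convex₃ R j R0≡0 a≤b = begin
  R j one + R j one              ≤⟨ ℚ.+-monoˡ-≤ (R j one) a≤b ⟩
  (R j two - R j one) + R j one  ≡⟨ solve 2 (λ a c → (c :- a) :+ a := con 0ℚ :+ c) refl
                                           (R j one) (R j two) ⟩
  0ℚ + R j two                   ≡⟨ cong (_+ R j two) (sym R0≡0) ⟩
  R j zero + R j two             ∎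
  where open ℚ.≤-Reasoning; open +-*-Solver

Aset-unique : ∀ (R : Rewards n) → Unique (Aset R)
Aset-unique {n} R = filter⁺ (λ j → bOf R j <? aOf R j) (allFin⁺ n)

Bset-unique : ∀ (R : Rewards n) → Unique (Bset R)
Bset-unique {n} R = filter⁺ (λ j → aOf R j ≤? bOf R j) (allFin⁺ n)

Aset-concave : ∀ (R : Rewards n) → (∀ j → R j zero ≡ 0ℚ) →
               VecAll.All Concave₃ (restrict R (Aset R))
Aset-concave {n} R R0≡0 =
  map⁺ (fromList⁺ (ListAll.map (λ {j} → b<a⇒concave₃ R j (R0≡0 j))
                               (all-filter (λ j → bOf R j <? aOf R j) (allFin n))))

Bset-convex : ∀ (R : Rewards n) → (∀ j → R j zero ≡ 0ℚ) →
              VecAll.All Convex₃ (restrict R (Bset R))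
Bset-convex {n} R R0≡0 =
  map⁺ (fromList⁺ (ListAll.map (λ {j} → a≤b⇒convex₃ R j (R0≡0 j))
                               (all-filter (λ j → aOf R j ≤? bOf R j) (allFin n))))

lemma8 : (n : ℕ) (R : Fin n → Fin 3 → ℚ) → (∀ j → R j zero ≡ 0ℚ)
    → (f g : ℕ → ℚ)
    → (∀ k → k ≤ 2 * length (Aset R) → IsMaxValue R (Aset R) k (f k))
    → (∀ k → k ≤ 2 * length (Bset R) → IsMaxValue R (Bset R) k (g k))
    → Concave (2 * length (Aset R)) f × OscConcave (2 * length (Bset R)) g
lemma8 n R R0≡0 f g f-max g-max =
    maxReward-concave f (Aset-concave R R0≡0)
      (λ k k≤2|A| → max-restrict (Aset-unique R) (f-max k k≤2|A|))
  , maxReward-oscConcave (length (Bset R)) g (Bset-convex R R0≡0)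
      (λ k k≤2|B| → max-restrict (Bset-unique R) (g-max k k≤2|B|))
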